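{- Let $R$ be a unital commutative ring, $\mathcal{R}$ a finitely generated $R$-algebra with generating set $\{t_1,\dots,t_l\}$, $T=\{r_0+\sum_i r_it_i : r_i\in R\}$, $n\ge2$, $I=\{0,\dots,n\}$, and $K_{\{n\}}=\langle e_{j,j+1}(m): j\in\{0,\dots,n-1\}, m\in T\rangle\le\operatorname{EL}_{n+1}(\mathcal{R})$. Then $K_{\{n\}}$ is the group of upper triangular matrices $A=(a_{k,j})\in\operatorname{EL}_{n+1}(\mathcal{R})$ with $1$'s on the main diagonal such that $a_{k,j}\in T^{j-k}$ for every $0\le k<j\le n$.
   Context: $e_{i,j}(r)$ ($i\ne j$) is the $(n+1)\times(n+1)$ matrix (rows/columns indexed $0,\dots,n$) with $1$'s on the diagonal, $r$ at $(i,j)$, $0$ elsewhere; $\operatorname{EL}_{n+1}(\mathcal{R})$ is the group they generate. $T^d$ denotes the $R$-module of all polynomial expressions in $1,t_1,\dots,t_l$ of degree at most $d$ (i.e. the $R$-span of products of at most $d$ elements of $T$). -}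

module Defs where

open import Level using (Level; _⊔_; suc)
open import Data.Nat using (ℕ; zero; _∸_; _≤_)
import Data.Nat as ℕ
open import Data.Fin using (Fin; toℕ; inject₁) renaming (suc to fsuc; zero to fzero)
open import Data.Product using (Σ; ∃; _×_; _,_)
open import Data.List using (List; []; _∷_; length)
open import Data.List.Relation.Unary.All using (All)
open import Relation.Binary.PropositionalEquality using (_≡_)
open import Relation.Nullary using (¬_)
open import Algebra.Bundles using (CommutativeRing; Ring)
open import Algebra.Morphism.Structures using (IsRingHomomorphism)

-- A (unital, associative) R-algebra: a ring A with a ring homomorphism
-- φ : R → A whose image is central.  Scalar action r · a = φ r * a.
record RAlgebra {c ℓ : Level} (R : CommutativeRing c ℓ) (a ℓa : Level)
       : Set (c ⊔ ℓ ⊔ suc (a ⊔ ℓa)) where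
  field
    ring : Ring a ℓa
  open Ring ring public
  private module R = CommutativeRing R
  field
    φ       : R.Carrier → Carrier
    φ-hom   : IsRingHomomorphism R.rawRing rawRing φ
    φ-central : ∀ r x → φ r * x ≈ x * φ r

module _ {a ℓa : Level} (A : Ring a ℓa) where
  open Ring A

  Σ[_] : (k : ℕ) → (Fin k → Carrier) → Carrier
  Σ[ zero ] f = 0#
  Σ[ ℕ.suc k ] f = f fzero + Σ[ k ] (λ i → f (fsuc i))

  prod : List Carrier → Carrier
  prod [] = 1#
  prod (x ∷ xs) = x * prod xs

  Mat : ℕ → Set a
  Mat m = Fin m → Fin m → Carrier

  _≈M_ : {m : ℕ} → Mat m → Mat m → Set ℓa
  M ≈M N = ∀ i j → M i j ≈ N i j

  _*M_ : {m : ℕ} → Mat m → Mat m → Mat m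
  _*M_ {m} M N i j = Σ[ m ] (λ k → M i k * N k j)

  δ : {m : ℕ} → Fin m → Fin m → Carrier
  δ fzero fzero = 1#
  δ fzero (fsuc j) = 0#
  δ (fsuc i) fzero = 0#
  δ (fsuc i) (fsuc j) = δ i j

  idM : {m : ℕ} → Mat m
  idM = δ

  elem : {m : ℕ} → Fin m → Fin m → Carrier → Mat m
  elem i j r k l with Data.Fin._≟_ k i | Data.Fin._≟_ l j
  ... | Relation.Nullary.yes _ | Relation.Nullary.yes _ = δ k l + r
  ... | _ | _ = δ k l

  -- The subgroup (of the group of invertible m×m matrices) generated by a
  -- set S of invertible matrices: closure of the identity under left
  -- multiplication by elements of S and by their inverses, up to ≈M.
  data Gen {m : ℕ} {p : Level} (S : Mat m → Set p) : Mat m → Set (a ⊔ ℓa ⊔ p) where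
    gen-id  : Gen S idM
    gen-mul : ∀ {g M} → S g → Gen S M → Gen S (g *M M)
    gen-inv : ∀ {g h M} → S g → (h *M g) ≈M idM → (g *M h) ≈M idM →
              Gen S M → Gen S (h *M M)
    gen-≈   : ∀ {M N} → M ≈M N → Gen S M → Gen S N

  Elementary : {m : ℕ} → Mat m → Set (a ⊔ ℓa)
  Elementary {m} M = Σ (Fin m) λ i → Σ (Fin m) λ j → Σ Carrier λ r →
                     (¬ i ≡ j) × (M ≈M elem i j r)

  EL : (m : ℕ) → Mat m → Set (a ⊔ ℓa)
  EL m = Gen {m} Elementary

module _ {c ℓ a ℓa : Level} {R : CommutativeRing c ℓ} (𝓡 : RAlgebra R a ℓa) where
  open RAlgebra 𝓡
  private module R = CommutativeRing R

  InT : {l : ℕ} → (Fin l → Carrier) → Carrier → Set (c ⊔ ℓa)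
  InT {l} t x = Σ R.Carrier λ r₀ → Σ (Fin l → R.Carrier) λ r →
                x ≈ φ r₀ + Σ[ ring ] l (λ i → φ (r i) * t i)

  ProdT : {l : ℕ} → (Fin l → Carrier) → ℕ → Carrier → Set (a ⊔ c ⊔ ℓa)
  ProdT t d x = Σ (List Carrier) λ xs → (length xs ≤ d) × All (InT t) xs ×
                (x ≈ prod ring xs)

  data TPow {l : ℕ} (t : Fin l → Carrier) (d : ℕ) : Carrier → Set (a ⊔ c ⊔ ℓa) where
    span-0   : TPow t d 0#
    span-add : ∀ {p y} (r : R.Carrier) → ProdT t d p → TPow t d y →
               TPow t d (φ r * p + y)
    span-≈   : ∀ {x y} → x ≈ y → TPow t d x → TPow t d y

  Generates : {l : ℕ} → (Fin l → Carrier) → Set (a ⊔ c ⊔ ℓa)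
  Generates t = ∀ x → ∃ λ d → TPow t d x

  KGens : {l : ℕ} → (Fin l → Carrier) → (n : ℕ) → Mat ring (ℕ.suc n) → Set (a ⊔ c ⊔ ℓa)
  KGens t n M = Σ (Fin n) λ j → Σ Carrier λ m →
                InT t m × (_≈M_ ring M (elem ring (inject₁ j) (fsuc j) m))

  K : {l : ℕ} → (Fin l → Carrier) → (n : ℕ) → Mat ring (ℕ.suc n) → Set (a ⊔ c ⊔ ℓa)
  K t n = Gen ring (KGens t n)

  UpperT : {l : ℕ} → (Fin l → Carrier) → (n : ℕ) → Mat ring (ℕ.suc n) → Set (a ⊔ c ⊔ ℓa)
  UpperT t n A =
    (∀ k → A k k ≈ 1#) ×
    (∀ k j → toℕ j Data.Nat.< toℕ k → A k j ≈ 0#) ×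
    (∀ k j → toℕ k Data.Nat.< toℕ j → TPow t (toℕ j ∸ toℕ k) (A k j))

-- A generator e_{j,j+1}(m), m ∈ T, adds m times row j+1 to row j, so the (j,c)-entry gains
-- m · a_{j+1,c} ∈ T · T^{c-j-1} ⊆ T^{c-j}: induction over the generators shows that K_{n} consists
-- of such unitriangular matrices.  Conversely, such a matrix is reached from the identity by row
-- operations e_{i,j}(x) with x ∈ T^{j-i}: clear the first row, then recurse on the lower right
-- block.  Each of these lies in K_{n} by induction on j - i, since x is a sum of multiples of
-- products u v with u ∈ T, v ∈ T^{j-i-1}, and e_{i,j}(u v) = [e_{i,i+1}(u), e_{i+1,j}(v)].

module Submission where

open import Defs
open import Level using (Level; _⊔_)
open import Data.Nat using (ℕ; zero; suc; _≤_; _<_; z≤n; s≤s; _∸_; _<?_) renaming (_+_ to _+ℕ_)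
import Data.Nat.Properties as ℕₚ
open import Data.Fin using (Fin; toℕ; _≟_; fromℕ<; inject₁) renaming (zero to fzero; suc to fsuc)
import Data.Fin.Properties as Finₚ
open import Data.Product using (Σ; _×_; _,_)
open import Data.List using ([]; _∷_)
open import Data.List.Relation.Unary.All using ([]; _∷_)
open import Data.Empty using (⊥-elim)
open import Function.Base using (_∘_)
open import Function.Bundles using (_⇔_; mk⇔)
open import Relation.Binary.PropositionalEquality as ≡ using (_≡_; _≢_)
open import Relation.Binary.Definitions using (tri<; tri≈; tri>)
open import Relation.Nullary using (yes; no; Dec)
open import Algebra.Bundles using (Ring; CommutativeRing)
open import Algebra.Morphism.Structures using (IsRingHomomorphism)

module RowOperations {a ℓa : Level} (Rg : Ring a ℓa) where
  open Ring Rg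
  open import Algebra.Properties.Ring Rg using (-‿distribˡ-*; x≈z//y)
  open import Algebra.Properties.CommutativeSemigroup +-commutativeSemigroup using (interchange)
  open import Relation.Binary.Reasoning.Setoid setoid

  Mx : ℕ → Set a
  Mx = Mat Rg

  infix 4 _≋_
  _≋_ : ∀ {m} → Mx m → Mx m → Set ℓa
  _≋_ = _≈M_ Rg

  infixl 7 _⊛_
  _⊛_ : ∀ {m} → Mx m → Mx m → Mx m
  _⊛_ = _*M_ Rg

  I : ∀ {m} → Mx m
  I = idM Rg

  ≋-sym : ∀ {m} {X Y : Mx m} → X ≋ Y → Y ≋ X
  ≋-sym X≋Y i j = sym (X≋Y i j)

  ≋-trans : ∀ {m} {X Y Z : Mx m} → X ≋ Y → Y ≋ Z → X ≋ Z
  ≋-trans X≋Y Y≋Z i j = trans (X≋Y i j) (Y≋Z i j)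

  Σ-cong : ∀ {k} {f g : Fin k → Carrier} → (∀ i → f i ≈ g i) → Σ[ Rg ] k f ≈ Σ[ Rg ] k g
  Σ-cong {zero} f≈g = refl
  Σ-cong {suc k} f≈g = +-cong (f≈g fzero) (Σ-cong (f≈g ∘ fsuc))

  Σ-zero : ∀ {k} {f : Fin k → Carrier} → (∀ i → f i ≈ 0#) → Σ[ Rg ] k f ≈ 0#
  Σ-zero {zero} f≈0 = refl
  Σ-zero {suc k} f≈0 = trans (+-cong (f≈0 fzero) (Σ-zero (f≈0 ∘ fsuc))) (+-identityˡ 0#)

  Σ-distrib-+ : ∀ {k} (f g : Fin k → Carrier) →
                Σ[ Rg ] k (λ i → f i + g i) ≈ Σ[ Rg ] k f + Σ[ Rg ] k g
  Σ-distrib-+ {zero} f g = sym (+-identityˡ 0#)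
  Σ-distrib-+ {suc k} f g =
    trans (+-congˡ (Σ-distrib-+ (f ∘ fsuc) (g ∘ fsuc))) (interchange _ _ _ _)

  *-distribˡ-Σ : ∀ {k} x (f : Fin k → Carrier) → Σ[ Rg ] k (λ i → x * f i) ≈ x * Σ[ Rg ] k f
  *-distribˡ-Σ {zero} x f = sym (zeroʳ x)
  *-distribˡ-Σ {suc k} x f = trans (+-congˡ (*-distribˡ-Σ x (f ∘ fsuc))) (sym (distribˡ x _ _))

  Σ-single : ∀ {k} (f : Fin k → Carrier) j → (∀ i → i ≢ j → f i ≈ 0#) →
             Σ[ Rg ] k f ≈ f j
  Σ-single f fzero f≈0 =
    trans (+-congˡ (Σ-zero (λ i → f≈0 (fsuc i) (λ ())))) (+-identityʳ _)
  Σ-single f (fsuc j) f≈0 =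
    trans (+-congʳ (f≈0 fzero (λ ())))
          (trans (+-identityˡ _)
                 (Σ-single (f ∘ fsuc) j (λ i i≢j → f≈0 (fsuc i) (i≢j ∘ Finₚ.suc-injective))))

  δ-refl : ∀ {m} (k : Fin m) → δ Rg k k ≡ 1#
  δ-refl fzero = ≡.refl
  δ-refl (fsuc k) = δ-refl k

  δ-≢ : ∀ {m} {k p : Fin m} → k ≢ p → δ Rg k p ≡ 0#
  δ-≢ {k = fzero} {fzero} k≢p = ⊥-elim (k≢p ≡.refl)
  δ-≢ {k = fzero} {fsuc p} k≢p = ≡.refl
  δ-≢ {k = fsuc k} {fzero} k≢p = ≡.refl
  δ-≢ {k = fsuc k} {fsuc p} k≢p = δ-≢ (k≢p ∘ ≡.cong fsuc)

  Σ-δˡ : ∀ {m} (k : Fin m) (g : Fin m → Carrier) → Σ[ Rg ] m (λ p → δ Rg k p * g p) ≈ g k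
  Σ-δˡ k g =
    trans (Σ-single _ k (λ p p≢k → trans (*-congʳ (reflexive (δ-≢ (p≢k ∘ ≡.sym))))
                                         (zeroˡ _)))
          (trans (*-congʳ (reflexive (δ-refl k))) (*-identityˡ _))

  Σ-δʳ : ∀ {m} (k : Fin m) (g : Fin m → Carrier) → Σ[ Rg ] m (λ p → g p * δ Rg p k) ≈ g k
  Σ-δʳ k g =
    trans (Σ-single _ k (λ p p≢k → trans (*-congˡ (reflexive (δ-≢ p≢k))) (zeroʳ _)))
          (trans (*-congˡ (reflexive (δ-refl k))) (*-identityʳ _))

  ⊛-congʳ : ∀ {m} {X Y : Mx m} (Z : Mx m) → X ≋ Y → X ⊛ Z ≋ Y ⊛ Z
  ⊛-congʳ Z X≋Y k c = Σ-cong (λ p → *-congʳ (X≋Y k p))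

  ⊛-identityʳ : ∀ {m} (X : Mx m) → X ⊛ I ≋ X
  ⊛-identityʳ X k c = Σ-δʳ c (X k)

  x+r*y≈x : ∀ {x y} r → y ≈ 0# → x + r * y ≈ x
  x+r*y≈x r y≈0 = trans (+-congˡ (trans (*-congˡ y≈0) (zeroʳ r))) (+-identityʳ _)

  addRow : ∀ {m} → Fin m → Fin m → Carrier → Mx m → Mx m
  addRow i j r X k c with k ≟ i
  ... | yes _ = X k c + r * X j c
  ... | no _ = X k c

  addRow-≡ : ∀ {m} (i j : Fin m) r X c → addRow i j r X i c ≡ X i c + r * X j c
  addRow-≡ i j r X c with i ≟ i
  ... | yes _ = ≡.refl
  ... | no i≢i = ⊥-elim (i≢i ≡.refl)

  addRow-≢ : ∀ {m} {i j : Fin m} {r X k} c → k ≢ i → addRow i j r X k c ≡ X k c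
  addRow-≢ {i = i} {k = k} c k≢i with k ≟ i
  ... | yes k≡i = ⊥-elim (k≢i k≡i)
  ... | no _ = ≡.refl

  addRow-elim : ∀ {p m} {i j : Fin m} {r X} (P : Fin m → Fin m → Carrier → Set p) →
                (∀ c → P i c (X i c + r * X j c)) → (∀ {k} c → k ≢ i → P k c (X k c)) →
                ∀ k c → P k c (addRow i j r X k c)
  addRow-elim {i = i} P onRow offRow k c with k ≟ i
  ... | yes ≡.refl = onRow c
  ... | no k≢i = offRow c k≢i

  addRow-cong : ∀ {m} (i j : Fin m) {r s X Y} → r ≈ s → X ≋ Y → addRow i j r X ≋ addRow i j s Y
  addRow-cong i j r≈s X≋Y k c with k ≟ i
  ... | yes _ = +-cong (X≋Y k c) (*-cong r≈s (X≋Y j c))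
  ... | no _ = X≋Y k c

  addRow-zero : ∀ {m} (i j : Fin m) (X : Mx m) → addRow i j 0# X ≋ X
  addRow-zero i j X k c with k ≟ i
  ... | yes _ = trans (+-congˡ (zeroˡ _)) (+-identityʳ _)
  ... | no _ = refl

  addRow-+ : ∀ {m} {i j : Fin m} x y (X : Mx m) → i ≢ j →
             addRow i j (x + y) X ≋ addRow i j x (addRow i j y X)
  addRow-+ {i = i} {j} x y X i≢j =
    addRow-elim (λ k c v → v ≈ addRow i j x (addRow i j y X) k c) onRow offRow
    where
    onRow : ∀ c → X i c + (x + y) * X j c ≈ addRow i j x (addRow i j y X) i c
    onRow c rewrite addRow-≡ i j x (addRow i j y X) c | addRow-≡ i j y X c
                  | addRow-≢ {i = i} {j} {y} {X} c (i≢j ∘ ≡.sym) = begin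
      X i c + (x + y) * X j c          ≈⟨ +-congˡ (trans (distribʳ _ x y) (+-comm _ _)) ⟩
      X i c + (y * X j c + x * X j c)  ≈⟨ +-assoc _ _ _ ⟨
      X i c + y * X j c + x * X j c    ∎
    offRow : ∀ {k} c → k ≢ i → X k c ≈ addRow i j x (addRow i j y X) k c
    offRow c k≢i rewrite addRow-≢ {i = i} {j} {x} {addRow i j y X} c k≢i
                       | addRow-≢ {i = i} {j} {y} {X} c k≢i = refl

  single : ∀ {m} → Fin m → Carrier → Fin m → Carrier
  single j r p with p ≟ j
  ... | yes _ = r
  ... | no _ = 0#

  elem-row : ∀ {m} (i j : Fin m) r p → elem Rg i j r i p ≈ δ Rg i p + single j r p
  elem-row i j r p with i ≟ i | p ≟ j
  ... | yes _ | yes ≡.refl = refl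
  ... | yes _ | no _ = sym (+-identityʳ _)
  ... | no i≢i | _ = ⊥-elim (i≢i ≡.refl)

  elem-otherRow : ∀ {m} {i j : Fin m} {r k} p → k ≢ i → elem Rg i j r k p ≡ δ Rg k p
  elem-otherRow {i = i} {j} {k = k} p k≢i with k ≟ i | p ≟ j
  ... | yes k≡i | _ = ⊥-elim (k≢i k≡i)
  ... | no _ | yes _ = ≡.refl
  ... | no _ | no _ = ≡.refl

  Σ-single-weight : ∀ {m} (j : Fin m) r (g : Fin m → Carrier) →
                    Σ[ Rg ] m (λ p → single j r p * g p) ≈ r * g j
  Σ-single-weight j r g =
    trans (Σ-single _ j (λ p p≢j → trans (*-congʳ (reflexive (off p p≢j))) (zeroˡ _)))
          (*-congʳ (reflexive on))
    where
    on : single j r j ≡ r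
    on with j ≟ j
    ... | yes _ = ≡.refl
    ... | no j≢j = ⊥-elim (j≢j ≡.refl)
    off : ∀ p → p ≢ j → single j r p ≡ 0#
    off p p≢j with p ≟ j
    ... | yes p≡j = ⊥-elim (p≢j p≡j)
    ... | no _ = ≡.refl

  elem-⊛ : ∀ {m} (i j : Fin m) r (X : Mx m) → elem Rg i j r ⊛ X ≋ addRow i j r X
  elem-⊛ {m} i j r X = addRow-elim (λ k c v → (elem Rg i j r ⊛ X) k c ≈ v) onRow offRow
    where
    onRow : ∀ c → (elem Rg i j r ⊛ X) i c ≈ X i c + r * X j c
    onRow c = begin
      Σ[ Rg ] m (λ p → elem Rg i j r i p * X p c)
        ≈⟨ Σ-cong (λ p → trans (*-congʳ (elem-row i j r p)) (distribʳ _ _ _)) ⟩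
      Σ[ Rg ] m (λ p → δ Rg i p * X p c + single j r p * X p c)
        ≈⟨ Σ-distrib-+ (λ p → δ Rg i p * X p c) (λ p → single j r p * X p c) ⟩
      Σ[ Rg ] m (λ p → δ Rg i p * X p c) + Σ[ Rg ] m (λ p → single j r p * X p c)
        ≈⟨ +-cong (Σ-δˡ i (λ p → X p c)) (Σ-single-weight j r (λ p → X p c)) ⟩
      X i c + r * X j c ∎
    offRow : ∀ {k} c → k ≢ i → (elem Rg i j r ⊛ X) k c ≈ X k c
    offRow {k} c k≢i =
      trans (Σ-cong (λ p → *-congʳ (reflexive (elem-otherRow p k≢i)))) (Σ-δˡ k (λ p → X p c))

  addRow-commutator : ∀ {m} {k q l : Fin m} a b (X : Mx m) → k ≢ q → q ≢ l → k ≢ l →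
    addRow k q a (addRow q l b (addRow k q (- a) (addRow q l (- b) X))) ≋ addRow k l (a * b) X
  addRow-commutator {k = k} {q} {l} a b X k≢q q≢l k≢l r c = rows (r ≟ k) (r ≟ q)
    where
    Y₁ = addRow q l (- b) X
    Y₂ = addRow k q (- a) Y₁
    Y₃ = addRow q l b Y₂
    rowk : ∀ xk u xl → (xk + (- a) * u) + a * (u + b * xl) ≈ xk + (a * b) * xl
    rowk xk u xl = begin
      (xk + (- a) * u) + a * (u + b * xl)       ≈⟨ +-cong (+-congˡ (sym (-‿distribˡ-* a u)))
                                                           (distribˡ a u (b * xl)) ⟩
      (xk + - (a * u)) + (a * u + a * (b * xl)) ≈⟨ +-assoc _ _ _ ⟩
      xk + (- (a * u) + (a * u + a * (b * xl))) ≈⟨ +-congˡ (+-assoc _ _ _) ⟨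
      xk + ((- (a * u) + a * u) + a * (b * xl)) ≈⟨ +-congˡ (+-congʳ (-‿inverseˡ _)) ⟩
      xk + (0# + a * (b * xl))                  ≈⟨ +-congˡ (+-identityˡ _) ⟩
      xk + a * (b * xl)                         ≈⟨ +-congˡ (*-assoc _ _ _) ⟨
      xk + (a * b) * xl                         ∎
    rowq : ∀ xq xl → (xq + (- b) * xl) + b * xl ≈ xq
    rowq xq xl = begin
      (xq + (- b) * xl) + b * xl ≈⟨ +-assoc _ _ _ ⟩
      xq + ((- b) * xl + b * xl) ≈⟨ +-congˡ (distribʳ _ _ _) ⟨
      xq + ((- b + b) * xl)      ≈⟨ +-congˡ (*-congʳ (-‿inverseˡ b)) ⟩
      xq + 0# * xl               ≈⟨ +-congˡ (zeroˡ _) ⟩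
      xq + 0#                    ≈⟨ +-identityʳ _ ⟩
      xq                         ∎
    rows : Dec (r ≡ k) → Dec (r ≡ q) → addRow k q a Y₃ r c ≈ addRow k l (a * b) X r c
    rows (yes ≡.refl) _
      rewrite addRow-≡ k q a Y₃ c | addRow-≡ k l (a * b) X c
            | addRow-≢ {i = q} {l} {b} {Y₂} c k≢q | addRow-≡ k q (- a) Y₁ c
            | addRow-≢ {i = q} {l} { - b} {X} c k≢q | addRow-≡ q l b Y₂ c
            | addRow-≢ {i = k} {q} { - a} {Y₁} c (k≢q ∘ ≡.sym)
            | addRow-≢ {i = k} {q} { - a} {Y₁} {l} c (k≢l ∘ ≡.sym)
            | addRow-≢ {i = q} {l} { - b} {X} {l} c (q≢l ∘ ≡.sym)
            | addRow-≡ q l (- b) X c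
      = rowk _ _ _
    rows (no r≢k) (yes ≡.refl)
      rewrite addRow-≢ {i = k} {q} {a} {Y₃} c r≢k | addRow-≢ {i = k} {l} {a * b} {X} c r≢k
            | addRow-≡ q l b Y₂ c | addRow-≢ {i = k} {q} { - a} {Y₁} c r≢k
            | addRow-≢ {i = k} {q} { - a} {Y₁} {l} c (k≢l ∘ ≡.sym)
            | addRow-≢ {i = q} {l} { - b} {X} {l} c (q≢l ∘ ≡.sym)
            | addRow-≡ q l (- b) X c
      = rowq _ _
    rows (no r≢k) (no r≢q)
      rewrite addRow-≢ {i = k} {q} {a} {Y₃} c r≢k | addRow-≢ {i = k} {l} {a * b} {X} c r≢k
            | addRow-≢ {i = q} {l} {b} {Y₂} c r≢q | addRow-≢ {i = k} {q} { - a} {Y₁} c r≢k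
            | addRow-≢ {i = q} {l} { - b} {X} c r≢q
      = refl

  elem-inverse : ∀ {m} {i j : Fin m} {r h} → i ≢ j → elem Rg i j r ⊛ h ≋ I →
                 h ≋ elem Rg i j (- r)
  elem-inverse {i = i} {j} {r} {h} i≢j eh≋I =
    ≋-trans h≋addRow (≋-trans (≋-sym (elem-⊛ i j (- r) I)) (⊛-identityʳ _))
    where
    addRow≋I : addRow i j r h ≋ I
    addRow≋I = ≋-trans (≋-sym (elem-⊛ i j r h)) eh≋I
    offRow : ∀ {k} c → k ≢ i → h k c ≈ I k c
    offRow {k} c k≢i = trans (reflexive (≡.sym (addRow-≢ {i = i} {j} {r} {h} c k≢i))) (addRow≋I k c)
    onRow : ∀ c → h i c ≈ I i c + (- r) * I j c
    onRow c = begin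
      h i c                 ≈⟨ x≈z//y _ _ _ (trans (reflexive (≡.sym (addRow-≡ i j r h c)))
                                                   (addRow≋I i c)) ⟩
      I i c + - (r * h j c) ≈⟨ +-congˡ (-‿cong (*-congˡ (offRow c (i≢j ∘ ≡.sym)))) ⟩
      I i c + - (r * I j c) ≈⟨ +-congˡ (-‿distribˡ-* r _) ⟩
      I i c + (- r) * I j c ∎
    h≋addRow : h ≋ addRow i j (- r) I
    h≋addRow = addRow-elim (λ k c v → h k c ≈ v) onRow offRow

  border : ∀ {m} → (Fin (suc m) → Carrier) → Mx m → Mx (suc m)
  border v X fzero c = v c
  border v X (fsuc i) fzero = 0#
  border v X (fsuc i) (fsuc j) = X i j

  border-cong : ∀ {m} {u v : Fin (suc m) → Carrier} {X Y : Mx m} →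
                (∀ c → u c ≈ v c) → X ≋ Y → border u X ≋ border v Y
  border-cong u≈v X≋Y fzero c = u≈v c
  border-cong u≈v X≋Y (fsuc i) fzero = refl
  border-cong u≈v X≋Y (fsuc i) (fsuc j) = X≋Y i j

  addRow-border : ∀ {m} (i j : Fin m) r v (X : Mx m) →
                  addRow (fsuc i) (fsuc j) r (border v X) ≋ border v (addRow i j r X)
  addRow-border i j r v X = addRow-elim (λ k c w → w ≈ border v (addRow i j r X) k c) onRow offRow
    where
    onRow : ∀ c → border v X (fsuc i) c + r * border v X (fsuc j) c ≈
                  border v (addRow i j r X) (fsuc i) c
    onRow fzero = trans (+-identityˡ _) (zeroʳ r)
    onRow (fsuc c) = sym (reflexive (addRow-≡ i j r X c))
    offRow : ∀ {k} c → k ≢ fsuc i → border v X k c ≈ border v (addRow i j r X) k c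
    offRow {fzero} c _ = refl
    offRow {fsuc k} fzero _ = refl
    offRow {fsuc k} (fsuc c) k≢i = sym (reflexive (addRow-≢ c (k≢i ∘ ≡.cong fsuc)))

  addRow-border-I : ∀ {m} (j : Fin m) x v →
                    addRow fzero (fsuc j) x (border v I) ≋ border (λ c → v c + x * δ Rg (fsuc j) c) I
  addRow-border-I j x v = addRow-elim (λ k c w → w ≈ border v′ I k c) onRow offRow
    where
    v′ = λ c → v c + x * δ Rg (fsuc j) c
    onRow : ∀ c → v c + x * border v I (fsuc j) c ≈ v c + x * δ Rg (fsuc j) c
    onRow fzero = refl
    onRow (fsuc c) = refl
    offRow : ∀ {k} c → k ≢ fzero → border v I k c ≈ border v′ I k c
    offRow {fzero} c 0≢0 = ⊥-elim (0≢0 ≡.refl)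
    offRow {fsuc k} fzero _ = refl
    offRow {fsuc k} (fsuc c) _ = refl

  firstRowUpTo : ∀ {m} → ℕ → (Fin (suc m) → Carrier) → Fin (suc m) → Carrier
  firstRowUpTo s v fzero = 1#
  firstRowUpTo s v (fsuc c) with toℕ c <? s
  ... | yes _ = v (fsuc c)
  ... | no _ = 0#

  border-firstRowUpTo-0 : ∀ {m} (v : Fin (suc m) → Carrier) → I ≋ border (firstRowUpTo 0 v) I
  border-firstRowUpTo-0 v fzero fzero = refl
  border-firstRowUpTo-0 v fzero (fsuc c) with toℕ c <? 0
  ... | no _ = refl
  border-firstRowUpTo-0 v (fsuc k) fzero = refl
  border-firstRowUpTo-0 v (fsuc k) (fsuc c) = refl

  firstRowUpTo-suc : ∀ {m} (v : Fin (suc m) → Carrier) {s} (s<m : s < m) c →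
                     let j = fsuc (fromℕ< s<m) in
                     firstRowUpTo s v c + v j * δ Rg j c ≈ firstRowUpTo (suc s) v c
  firstRowUpTo-suc v s<m fzero = x+r*y≈x _ refl
  firstRowUpTo-suc v {s} s<m (fsuc c) with toℕ c <? s | toℕ c <? suc s
  ... | yes c<s | yes _ = x+r*y≈x _ (reflexive (δ-≢ (Finₚ.<⇒≢ c<j ∘ ≡.sym)))
    where
    c<j : toℕ c < toℕ (fromℕ< s<m)
    c<j = ≡.subst (toℕ c <_) (≡.sym (Finₚ.toℕ-fromℕ< s<m)) c<s
  ... | yes c<s | no c≮1+s = ⊥-elim (c≮1+s (ℕₚ.m<n⇒m<1+n c<s))
  ... | no c≮s | no c≮1+s = x+r*y≈x _ (reflexive (δ-≢ j≢c))
    where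
    j≢c : fromℕ< s<m ≢ c
    j≢c j≡c = c≮1+s (≡.subst (λ i → toℕ i < suc s) j≡c
                             (≡.subst (_< suc s) (≡.sym (Finₚ.toℕ-fromℕ< s<m)) (ℕₚ.n<1+n s)))
  ... | no c≮s | yes c<1+s =
    trans (+-identityˡ _) (≡.subst (λ i → v (fsuc i) * δ Rg i c ≈ v (fsuc c)) (≡.sym j≡c)
                                   (trans (*-congˡ (reflexive (δ-refl c))) (*-identityʳ _)))
    where
    j≡c : fromℕ< s<m ≡ c
    j≡c = Finₚ.toℕ-injective
            (≡.trans (Finₚ.toℕ-fromℕ< s<m) (ℕₚ.≤-antisym (ℕₚ.≮⇒≥ c≮s) (ℕₚ.≤-pred c<1+s)))

  firstRowUpTo-all : ∀ {m} (v : Fin (suc m) → Carrier) c → firstRowUpTo m v (fsuc c) ≡ v (fsuc c)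
  firstRowUpTo-all {m} v c with toℕ c <? m
  ... | yes _ = ≡.refl
  ... | no c≮m = ⊥-elim (c≮m (Finₚ.toℕ<n c))

module TPowers {c ℓ a ℓa : Level} {R : CommutativeRing c ℓ} (𝓡 : RAlgebra R a ℓa)
               {l : ℕ} (t : Fin l → RAlgebra.Carrier 𝓡) where
  open RAlgebra 𝓡
  private module R = CommutativeRing R
  open IsRingHomomorphism φ-hom using (+-homo; *-homo; 0#-homo; 1#-homo; -‿homo)
  open RowOperations ring using (Σ-cong; Σ-zero; Σ-distrib-+; *-distribˡ-Σ)
  open import Algebra.Properties.Ring ring using (-1*x≈-x)
  open import Algebra.Properties.CommutativeSemigroup +-commutativeSemigroup using (interchange)
  open import Relation.Binary.Reasoning.Setoid setoid

  T : Carrier → Set (c ⊔ ℓa)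
  T = InT 𝓡 t

  T^_ : ℕ → Carrier → Set (a ⊔ c ⊔ ℓa)
  T^_ = TPow 𝓡 t

  linear : R.Carrier → (Fin l → R.Carrier) → Carrier
  linear r₀ r = φ r₀ + Σ[ ring ] l (λ i → φ (r i) * t i)

  T-resp-≈ : ∀ {x y} → x ≈ y → T x → T y
  T-resp-≈ x≈y (r₀ , r , x≈) = r₀ , r , trans (sym x≈y) x≈

  T-φ : ∀ s → T (φ s)
  T-φ s = s , (λ _ → R.0#) ,
    sym (trans (+-congˡ (Σ-zero {l} (λ i → trans (*-congʳ 0#-homo) (zeroˡ _)))) (+-identityʳ _))

  T-+ : ∀ {x y} → T x → T y → T (x + y)
  T-+ {x} {y} (r₀ , r , x≈) (s₀ , s , y≈) = r₀ R.+ s₀ , (λ i → r i R.+ s i) , (begin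
    x + y                                   ≈⟨ +-cong x≈ y≈ ⟩
    linear r₀ r + linear s₀ s               ≈⟨ interchange _ _ _ _ ⟩
    (φ r₀ + φ s₀) + (Σ[ ring ] l (λ i → φ (r i) * t i) + Σ[ ring ] l (λ i → φ (s i) * t i))
      ≈⟨ +-cong (sym (+-homo r₀ s₀))
                (trans (sym (Σ-distrib-+ (λ i → φ (r i) * t i) (λ i → φ (s i) * t i)))
                       (Σ-cong {l} (λ i → trans (sym (distribʳ _ _ _))
                                                (*-congʳ (sym (+-homo _ _)))))) ⟩
    linear (r₀ R.+ s₀) (λ i → r i R.+ s i)  ∎)

  T-φ* : ∀ s {x} → T x → T (φ s * x)
  T-φ* s {x} (r₀ , r , x≈) = s R.* r₀ , (λ i → s R.* r i) , (begin
    φ s * x                  ≈⟨ *-congˡ x≈ ⟩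
    φ s * linear r₀ r        ≈⟨ distribˡ _ _ _ ⟩
    φ s * φ r₀ + φ s * Σ[ ring ] l (λ i → φ (r i) * t i)
      ≈⟨ +-cong (sym (*-homo s r₀))
                (trans (sym (*-distribˡ-Σ (φ s) (λ i → φ (r i) * t i)))
                       (Σ-cong {l} (λ i → trans (sym (*-assoc _ _ _)) (*-congʳ (sym (*-homo _ _)))))) ⟩
    linear (s R.* r₀) (λ i → s R.* r i) ∎)

  φ[-1]*x≈-x : ∀ x → φ (R.- R.1#) * x ≈ - x
  φ[-1]*x≈-x x = trans (*-congʳ (trans (-‿homo R.1#) (-‿cong 1#-homo))) (-1*x≈-x x)

  T-neg : ∀ {x} → T x → T (- x)
  T-neg {x} Tx = T-resp-≈ (φ[-1]*x≈-x x) (T-φ* (R.- R.1#) Tx)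

  T^-+ : ∀ {d x y} → (T^ d) x → (T^ d) y → (T^ d) (x + y)
  T^-+ span-0 Ty = span-≈ (sym (+-identityˡ _)) Ty
  T^-+ (span-add r p Tx) Ty = span-≈ (sym (+-assoc _ _ _)) (span-add r p (T^-+ Tx Ty))
  T^-+ (span-≈ x≈ Tx) Ty = span-≈ (+-congʳ x≈) (T^-+ Tx Ty)

  T^-φ* : ∀ s {d x} → (T^ d) x → (T^ d) (φ s * x)
  T^-φ* s span-0 = span-≈ (sym (zeroʳ _)) span-0
  T^-φ* s (span-add r p Ty) =
    span-≈ (trans (+-congʳ (trans (*-congʳ (*-homo s r)) (*-assoc _ _ _))) (sym (distribˡ _ _ _)))
           (span-add (s R.* r) p (T^-φ* s Ty))
  T^-φ* s (span-≈ x≈ Tx) = span-≈ (*-congˡ x≈) (T^-φ* s Tx)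

  T^-neg : ∀ {d x} → (T^ d) x → (T^ d) (- x)
  T^-neg {x = x} Tx = span-≈ (φ[-1]*x≈-x x) (T^-φ* (R.- R.1#) Tx)

  T^-mono : ∀ {d d′ x} → d ≤ d′ → (T^ d) x → (T^ d′) x
  T^-mono d≤d′ span-0 = span-0
  T^-mono d≤d′ (span-add r (xs , len≤ , Txs , p≈) Ty) =
    span-add r (xs , ℕₚ.≤-trans len≤ d≤d′ , Txs , p≈) (T^-mono d≤d′ Ty)
  T^-mono d≤d′ (span-≈ x≈ Tx) = span-≈ x≈ (T^-mono d≤d′ Tx)

  T*T^ : ∀ {m d x} → T m → (T^ d) x → (T^ suc d) (m * x)
  T*T^ {m} Tm span-0 = span-≈ (sym (zeroʳ m)) span-0
  T*T^ {m} Tm (span-add {p} {y} r (xs , len≤ , Txs , p≈) Ty) =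
    span-≈ scalar-past-m (span-add r (m ∷ xs , s≤s len≤ , Tm ∷ Txs , *-congˡ p≈) (T*T^ Tm Ty))
    where
    scalar-past-m : φ r * (m * p) + m * y ≈ m * (φ r * p + y)
    scalar-past-m = begin
      φ r * (m * p) + m * y  ≈⟨ +-congʳ (*-assoc _ _ _) ⟨
      (φ r * m) * p + m * y  ≈⟨ +-congʳ (*-congʳ (φ-central r m)) ⟩
      (m * φ r) * p + m * y  ≈⟨ +-congʳ (*-assoc _ _ _) ⟩
      m * (φ r * p) + m * y  ≈⟨ distribˡ _ _ _ ⟨
      m * (φ r * p + y)      ∎
  T*T^ Tm (span-≈ x≈ Tx) = span-≈ (*-congˡ x≈) (T*T^ Tm Tx)

  ProdT⇒T^ : ∀ {d p} → ProdT 𝓡 t d p → (T^ d) p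
  ProdT⇒T^ P =
    span-≈ (trans (+-identityʳ _) (trans (*-congʳ 1#-homo) (*-identityˡ _))) (span-add R.1# P span-0)

  T⇒T^1 : ∀ {x} → T x → (T^ 1) x
  T⇒T^1 {x} Tx = ProdT⇒T^ (x ∷ [] , s≤s z≤n , Tx ∷ [] , sym (*-identityʳ x))

  T^1⇒T : ∀ {x} → (T^ 1) x → T x
  T^1⇒T span-0 = T-resp-≈ 0#-homo (T-φ R.0#)
  T^1⇒T (span-add r ([] , _ , _ , p≈) Ty) =
    T-+ (T-φ* r (T-resp-≈ (trans 1#-homo (sym p≈)) (T-φ R.1#))) (T^1⇒T Ty)
  T^1⇒T (span-add r (x ∷ [] , _ , Tx ∷ [] , p≈) Ty) =
    T-+ (T-φ* r (T-resp-≈ (sym (trans p≈ (*-identityʳ x))) Tx)) (T^1⇒T Ty)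
  T^1⇒T (span-add r (_ ∷ _ ∷ _ , s≤s () , _ , _) Ty)
  T^1⇒T (span-≈ x≈ Tx) = T-resp-≈ x≈ (T^1⇒T Tx)

  φ*ProdT-split : ∀ {d} r {p} → ProdT 𝓡 t (suc (suc d)) p →
                  Σ Carrier λ u → Σ Carrier λ v → T u × (T^ suc d) v × (φ r * p ≈ u * v)
  φ*ProdT-split r ([] , _ , _ , p≈) =
    φ r , 1# , T-φ r , ProdT⇒T^ ([] , z≤n , [] , refl) , *-congˡ p≈
  φ*ProdT-split r (x ∷ xs , s≤s len≤ , Tx ∷ Txs , p≈) =
    φ r * x , prod ring xs , T-φ* r Tx , ProdT⇒T^ (xs , len≤ , Txs , refl) ,
    trans (*-congˡ p≈) (sym (*-assoc _ _ _))

gap⇒≢ : ∀ {m} d {i j : Fin m} → toℕ j ≡ suc d +ℕ toℕ i → i ≢ j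
gap⇒≢ d {i} j≡ = Finₚ.<⇒≢ (≡.subst (toℕ i <_) (≡.sym j≡) (s≤s (ℕₚ.m≤n+m (toℕ i) d)))

inject₁<suc : ∀ {m} (j : Fin m) → toℕ (inject₁ j) < toℕ (fsuc j)
inject₁<suc j = Finₚ.≤̄⇒inject₁< ℕₚ.≤-refl

index-between : ∀ {m} d (i j : Fin m) → toℕ j ≡ suc (suc d) +ℕ toℕ i →
                Σ (Fin m) λ q → toℕ q ≡ suc (toℕ i) × toℕ j ≡ suc d +ℕ toℕ q
index-between {m} d i j j≡ = fromℕ< i+1<m , Finₚ.toℕ-fromℕ< i+1<m ,
  ≡.trans j≡ (≡.cong suc (≡.trans (≡.sym (ℕₚ.+-suc d (toℕ i)))
                                  (≡.cong (d +ℕ_) (≡.sym (Finₚ.toℕ-fromℕ< i+1<m)))))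
  where
  i+1<m : suc (toℕ i) < m
  i+1<m = ℕₚ.≤-trans (≡.subst (suc (suc (toℕ i)) ≤_) (≡.sym j≡) (s≤s (s≤s (ℕₚ.m≤n+m (toℕ i) d))))
                     (ℕₚ.<⇒≤ (Finₚ.toℕ<n j))

module Reduction {c ℓ a ℓa : Level} {R : CommutativeRing c ℓ} (𝓡 : RAlgebra R a ℓa)
                 {l : ℕ} (t : Fin l → RAlgebra.Carrier 𝓡) where
  open RAlgebra 𝓡
  open RowOperations ring
  open TPowers 𝓡 t

  Admissible : ∀ {m} → Fin m → Fin m → Carrier → Set (a ⊔ c ⊔ ℓa)
  Admissible i j x = Σ ℕ λ d → (toℕ j ≡ suc d +ℕ toℕ i) × (T^ suc d) x

  data Reachable {m : ℕ} : Mx m → Mx m → Set (a ⊔ c ⊔ ℓa) where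
    done : ∀ {X Y} → X ≋ Y → Reachable X Y
    step : ∀ {i j x X Y} → Admissible i j x → Reachable (addRow i j x X) Y → Reachable X Y

  Reachable-≋ˡ : ∀ {m} {X Y Z : Mx m} → X ≋ Y → Reachable Y Z → Reachable X Z
  Reachable-≋ˡ X≋Y (done Y≋Z) = done (≋-trans X≋Y Y≋Z)
  Reachable-≋ˡ X≋Y (step {i} {j} adm Y↝Z) =
    step adm (Reachable-≋ˡ (addRow-cong i j refl X≋Y) Y↝Z)

  Reachable-trans : ∀ {m} {X Y Z : Mx m} → Reachable X Y → Reachable Y Z → Reachable X Z
  Reachable-trans (done X≋Y) Y↝Z = Reachable-≋ˡ X≋Y Y↝Z
  Reachable-trans (step adm X↝Y) Y↝Z = step adm (Reachable-trans X↝Y Y↝Z)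

  Reachable-border : ∀ {m} (v : Fin (suc m) → Carrier) {X Y : Mx m} →
                     Reachable X Y → Reachable (border v X) (border v Y)
  Reachable-border v (done X≋Y) = done (border-cong (λ _ → refl) X≋Y)
  Reachable-border v {X} (step {i} {j} {x} (d , j≡ , Tx) X↝Y) =
    step (d , ≡.cong suc (≡.trans j≡ (≡.sym (ℕₚ.+-suc d (toℕ i)))) , Tx)
         (Reachable-≋ˡ (addRow-border i j x v X) (Reachable-border v X↝Y))

  Upper : ∀ m → Mx m → Set (a ⊔ c ⊔ ℓa)
  Upper m A = (∀ k → A k k ≈ 1#) × (∀ k j → toℕ j < toℕ k → A k j ≈ 0#) ×
              (∀ k j → toℕ k < toℕ j → (T^ (toℕ j ∸ toℕ k)) (A k j))

  sweepFirstRow : ∀ {m} (A : Mx (suc m)) → Upper (suc m) A → ∀ s → s ≤ m →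
                  Reachable (border (firstRowUpTo 0 (A fzero)) I) (border (firstRowUpTo s (A fzero)) I)
  sweepFirstRow A UA zero _ = done (λ _ _ → refl)
  sweepFirstRow A UA@(_ , _ , above) (suc s) s<m =
    Reachable-trans (sweepFirstRow A UA s (ℕₚ.<⇒≤ s<m))
      (step (toℕ j , ≡.cong suc (≡.sym (ℕₚ.+-identityʳ _)) , above fzero (fsuc j) (s≤s z≤n))
            (done (≋-trans (addRow-border-I j _ _)
                           (border-cong (firstRowUpTo-suc (A fzero) s<m) (λ _ _ → refl)))))
    where
    j = fromℕ< s<m

  Upper⇒Reachable : ∀ m {A : Mx m} → Upper m A → Reachable I A
  Upper⇒Reachable zero _ = done (λ ())
  Upper⇒Reachable (suc m) {A} UA@(diag , below , above) =
    Reachable-trans (Reachable-≋ˡ (border-firstRowUpTo-0 (A fzero)) (sweepFirstRow A UA m ℕₚ.≤-refl))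
      (Reachable-trans (Reachable-border _ (Upper⇒Reachable m UA′)) (done border≋A))
    where
    A′ : Mx m
    A′ i j = A (fsuc i) (fsuc j)
    UA′ : Upper m A′
    UA′ = diag ∘ fsuc ,
          (λ k j → below (fsuc k) (fsuc j) ∘ s≤s) ,
          (λ k j → above (fsuc k) (fsuc j) ∘ s≤s)
    border≋A : border (firstRowUpTo m (A fzero)) A′ ≋ A
    border≋A fzero fzero = sym (diag fzero)
    border≋A fzero (fsuc j) = reflexive (firstRowUpTo-all (A fzero) j)
    border≋A (fsuc i) fzero = sym (below (fsuc i) fzero (s≤s z≤n))
    border≋A (fsuc i) (fsuc j) = refl

  Upper-I : ∀ {m} → Upper m I
  Upper-I = (λ k → reflexive (δ-refl k)) ,
            (λ k j j<k → reflexive (δ-≢ (Finₚ.<⇒≢ j<k ∘ ≡.sym))) ,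
            (λ k j k<j → span-≈ (sym (reflexive (δ-≢ (Finₚ.<⇒≢ k<j)))) span-0)

  Upper-resp-≋ : ∀ {m} {A B : Mx m} → A ≋ B → Upper m A → Upper m B
  Upper-resp-≋ A≋B (diag , below , above) =
    (λ k → trans (sym (A≋B k k)) (diag k)) ,
    (λ k j j<k → trans (sym (A≋B k j)) (below k j j<k)) ,
    (λ k j k<j → span-≈ (A≋B k j) (above k j k<j))

  Upper-addRow₁ : ∀ {m} (j : Fin m) {x A} → T x → Upper (suc m) A →
                  Upper (suc m) (addRow (inject₁ j) (fsuc j) x A)
  Upper-addRow₁ j {x} {A} Tx (diag , below , above) =
    (λ k → addRow-elim (λ k c v → k ≡ c → v ≈ 1#) diag-onRow (λ { c _ ≡.refl → diag c })
                       k k ≡.refl) ,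
    addRow-elim (λ k c v → toℕ c < toℕ k → v ≈ 0#) below-onRow (λ c _ → below _ c) ,
    addRow-elim (λ k c v → toℕ k < toℕ c → (T^ (toℕ c ∸ toℕ k)) v)
                (λ c i<c → T^-+ (above i c i<c) (x*nextRow c i<c)) (λ c _ → above _ c)
    where
    i = inject₁ j
    i≡j : toℕ i ≡ toℕ j
    i≡j = Finₚ.toℕ-inject₁ j
    diag-onRow : ∀ c → i ≡ c → A i c + x * A (fsuc j) c ≈ 1#
    diag-onRow c ≡.refl = trans (x+r*y≈x x (below (fsuc j) i (inject₁<suc j))) (diag i)
    below-onRow : ∀ c → toℕ c < toℕ i → A i c + x * A (fsuc j) c ≈ 0#
    below-onRow c c<i =
      trans (x+r*y≈x x (below (fsuc j) c (ℕₚ.<-trans c<i (inject₁<suc j)))) (below i c c<i)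
    x*nextRow : ∀ c → toℕ i < toℕ c → (T^ (toℕ c ∸ toℕ i)) (x * A (fsuc j) c)
    x*nextRow c i<c with ℕₚ.<-cmp (toℕ (fsuc j)) (toℕ c)
    ... | tri< j+1<c _ _ = T^-mono (ℕₚ.≤-reflexive degree≡) (T*T^ Tx (above (fsuc j) c j+1<c))
      where
      degree≡ : suc (toℕ c ∸ suc (toℕ j)) ≡ toℕ c ∸ toℕ i
      degree≡ = ≡.trans (≡.sym (ℕₚ.+-∸-assoc 1 (ℕₚ.<⇒≤ j+1<c)))
                        (≡.cong (toℕ c ∸_) (≡.sym i≡j))
    ... | tri> _ _ c<j+1 = ⊥-elim (ℕₚ.<⇒≱ (≡.subst (_< toℕ c) i≡j i<c) (ℕₚ.≤-pred c<j+1))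
    ... | tri≈ _ j+1≡c _ with Finₚ.toℕ-injective {i = fsuc j} {j = c} j+1≡c
    ... | ≡.refl =
      T^-mono (ℕₚ.m<n⇒0<n∸m i<c) (T⇒T^1 (T-resp-≈ (sym (trans (*-congˡ (diag c)) (*-identityʳ x))) Tx))

module Generation {c ℓ a ℓa : Level} {R : CommutativeRing c ℓ} (𝓡 : RAlgebra R a ℓa)
                  {l : ℕ} (t : Fin l → RAlgebra.Carrier 𝓡) (n : ℕ) where
  open RAlgebra 𝓡
  open RowOperations ring
  open TPowers 𝓡 t
  open Reduction 𝓡 t

  K-addRow₁ : ∀ (i j : Fin (suc n)) {x X} → toℕ j ≡ suc (toℕ i) → T x →
              K 𝓡 t n X → K 𝓡 t n (addRow i j x X)
  K-addRow₁ i (fsuc j) {x} {X} j≡ Tx KX =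
    ≡.subst (λ i → K 𝓡 t n (addRow i (fsuc j) x X)) i≡
            (gen-≈ (elem-⊛ _ _ x X) (gen-mul (j , x , Tx , (λ _ _ → refl)) KX))
    where
    i≡ : inject₁ j ≡ i
    i≡ = Finₚ.toℕ-injective (≡.trans (Finₚ.toℕ-inject₁ j) (ℕₚ.suc-injective j≡))

  -- e_{i,j}(uv) is the commutator of e_{i,i+1}(u) and e_{i+1,j}(v), with u ∈ T and v ∈ T^{d+1}
  K-addRow : ∀ d (i j : Fin (suc n)) → toℕ j ≡ suc d +ℕ toℕ i → ∀ {x} → (T^ suc d) x →
             ∀ {X} → K 𝓡 t n X → K 𝓡 t n (addRow i j x X)
  K-addRow zero i j j≡ Tx KX = K-addRow₁ i j j≡ (T^1⇒T Tx) KX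
  K-addRow (suc d) i j j≡ span-0 {X} KX = gen-≈ (≋-sym (addRow-zero i j X)) KX
  K-addRow (suc d) i j j≡ (span-add {p} r P Ty) {X} KX =
    gen-≈ (≋-sym (addRow-+ _ _ X (gap⇒≢ (suc d) j≡)))
          (K-addRow-φ*ProdT (K-addRow (suc d) i j j≡ Ty KX))
    where
    K-addRow-φ*ProdT : ∀ {Y} → K 𝓡 t n Y → K 𝓡 t n (addRow i j (φ r * p) Y)
    K-addRow-φ*ProdT {Y} KY with φ*ProdT-split r P | index-between d i j j≡
    ... | u , v , Tu , Tv , φrp≈uv | q , q≡ , j≡′ =
      gen-≈ (≋-trans (addRow-commutator u v Y (gap⇒≢ 0 q≡) (gap⇒≢ d j≡′) (gap⇒≢ (suc d) j≡))
                     (addRow-cong i j (sym φrp≈uv) (λ _ _ → refl)))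
            (K-addRow₁ i q q≡ Tu (K-addRow d q j j≡′ Tv
              (K-addRow₁ i q q≡ (T-neg Tu) (K-addRow d q j j≡′ (T^-neg Tv) KY))))
  K-addRow (suc d) i j j≡ (span-≈ x≈y Tx) KX =
    gen-≈ (addRow-cong i j x≈y (λ _ _ → refl)) (K-addRow (suc d) i j j≡ Tx KX)

  K-Reachable : ∀ {X Y} → K 𝓡 t n X → Reachable X Y → K 𝓡 t n Y
  K-Reachable KX (done X≋Y) = gen-≈ X≋Y KX
  K-Reachable KX (step {i} {j} (d , j≡ , Tx) X↝Y) = K-Reachable (K-addRow d i j j≡ Tx KX) X↝Y

  inject₁≢suc : ∀ (j : Fin n) → inject₁ j ≢ fsuc j
  inject₁≢suc j = Finₚ.<⇒≢ (inject₁<suc j)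

  K⇒Upper : ∀ {A} → K 𝓡 t n A → Upper (suc n) A
  K⇒Upper gen-id = Upper-I
  K⇒Upper (gen-mul {M = M} (j , x , Tx , g≋) KM) =
    Upper-resp-≋ (≋-sym (≋-trans (⊛-congʳ M g≋) (elem-⊛ _ _ x M)))
                 (Upper-addRow₁ j Tx (K⇒Upper KM))
  K⇒Upper (gen-inv {h = h} {M} (j , x , Tx , g≋) hg≋I gh≋I KM) =
    Upper-resp-≋ (≋-sym (≋-trans (⊛-congʳ M h≋) (elem-⊛ _ _ (- x) M)))
                 (Upper-addRow₁ j (T-neg Tx) (K⇒Upper KM))
    where
    h≋ : h ≋ elem ring (inject₁ j) (fsuc j) (- x)
    h≋ = elem-inverse (inject₁≢suc j) (≋-trans (≋-sym (⊛-congʳ h g≋)) gh≋I)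
  K⇒Upper (gen-≈ A≋B KA) = Upper-resp-≋ A≋B (K⇒Upper KA)

  K⇒EL : ∀ {A} → K 𝓡 t n A → EL ring (suc n) A
  K⇒EL gen-id = gen-id
  K⇒EL (gen-mul (j , x , _ , g≋) KM) =
    gen-mul (inject₁ j , fsuc j , x , inject₁≢suc j , g≋) (K⇒EL KM)
  K⇒EL (gen-inv {g} {h} (j , x , _ , g≋) hg≋I gh≋I KM) =
    gen-inv {g = g} {h = h} (inject₁ j , fsuc j , x , inject₁≢suc j , g≋) hg≋I gh≋I (K⇒EL KM)
  K⇒EL (gen-≈ A≋B KA) = gen-≈ A≋B (K⇒EL KA)

lemma3p1 : {c ℓ a ℓa : Level} (R : CommutativeRing c ℓ) (𝓡 : RAlgebra R a ℓa)
           (l : ℕ) (t : Fin l → RAlgebra.Carrier 𝓡) → Generates 𝓡 t →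
           (n : ℕ) → 2 ≤ n → (A : Mat (RAlgebra.ring 𝓡) (suc n)) →
           K 𝓡 t n A ⇔ (EL (RAlgebra.ring 𝓡) (suc n) A × UpperT 𝓡 t n A)
lemma3p1 R 𝓡 l t _ n _ A =
  mk⇔ (λ KA → K⇒EL KA , K⇒Upper KA)
      (λ (_ , UA) → K-Reachable gen-id (Upper⇒Reachable (suc n) UA))
  where
  open Reduction 𝓡 t
  open Generation 𝓡 t n
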